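{- For any integers $0<d\le r\le n$, the following identity holds in $\mathbb{Z}[x_1,\ldots,x_n]$: $$e_d(1,\ldots,r)=(-1)^d\,\tilde e_d(r+1,\ldots,n)+\sum_{t=1}^d(-1)^{t+1}\,e_{d-t}(t+1,\ldots,r)\,\tilde e_t(t,\ldots,n).$$
   Context: For $S\subseteq\{1,\ldots,n\}$ and an integer $d$: $e_d(S)$ is the sum of all squarefree monomials $x_{i_1}\cdots x_{i_d}$ with $i_1<\cdots<i_d$ in $S$, and $\tilde e_d(S)$ is the sum of all monomials $x_{i_1}\cdots x_{i_d}$ with $i_1\le\cdots\le i_d$ in $S$. Conventions: $e_0(S)=\tilde e_0(S)=1$ (including $S=\emptyset$); both vanish for $d<0$; $e_d(S)=0$ for $d>|S|$; $\tilde e_d(\emptyset)=0$ for $d>0$. The notation $e_d(a,\ldots,b)$, $\tilde e_d(a,\ldots,b)$ means $S=\{a,a+1,\ldots,b\}$ (empty if $a>b$). -}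

module Defs where

open import Data.Nat using (ℕ; zero; suc; _∸_) renaming (_+_ to _+ℕ_)
open import Data.List using (List; []; _∷_; [_]; map; _++_; foldr; upTo)
open import Algebra.Bundles using (CommutativeRing)

-- the index set {a, a+1, ..., b} as an increasing list (empty if a > b)
range : ℕ → ℕ → List ℕ
range a b = map (a +ℕ_) (upTo (suc b ∸ a))

choose : ℕ → List ℕ → List (List ℕ)
choose zero    _        = [ [] ]
choose (suc d) []       = []
choose (suc d) (i ∷ is) = map (i ∷_) (choose d is) ++ choose (suc d) is

multichoose : ℕ → List ℕ → List (List ℕ)
multichoose zero    _        = [ [] ]
multichoose (suc d) []       = []
multichoose (suc d) (i ∷ is) = map (i ∷_) (multichoose d (i ∷ is)) ++ multichoose (suc d) is

module Sym {c ℓ} (R : CommutativeRing c ℓ) (x : ℕ → CommutativeRing.Carrier R) where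
  open CommutativeRing R

  sumR : List Carrier → Carrier
  sumR = foldr _+_ 0#

  monomial : List ℕ → Carrier
  monomial is = foldr _*_ 1# (map x is)

  e : ℕ → ℕ → ℕ → Carrier
  e d a b = sumR (map monomial (choose d (range a b)))

  ẽ : ℕ → ℕ → ℕ → Carrier
  ẽ d a b = sumR (map monomial (multichoose d (range a b)))

  sgn : ℕ → Carrier
  sgn zero    = 1#
  sgn (suc k) = - 1# * sgn k

  sumRange : ℕ → ℕ → (ℕ → Carrier) → Carrier
  sumRange a b f = sumR (map f (range a b))

-- Let Φ(a) = Σ_{t=0}^{d} (-1)^t e_{d-t}(a+t+1, …, r) ẽ_t(a+t, …, n); the theorem says
-- Φ(0) = (-1)^d ẽ_d(r+1, …, n). Splitting off the variable x_{a+t+1} in both e_{d-t}(a+t+1, …, r)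
-- and ẽ_{t+1}(a+t+1, …, n) makes Φ(a) - Φ(a+1) a telescoping alternating sum, so Φ(a) = Φ(a+1)
-- while a + d ≤ r. At a = r + 1 - d every factor e_{d-t} with t < d has degree larger than its
-- number of variables, and only the term t = d, namely (-1)^d ẽ_d(r+1, …, n), survives.

module Submission where

open import Defs
open import Data.Nat using (ℕ; suc; _∸_; _<_; _≤_)
open import Algebra.Bundles using (CommutativeRing)
open import Data.Nat using (zero; s≤s; z<s) renaming (_+_ to _+ℕ_)
import Data.Nat.Properties as ℕₚ
open import Data.List using (List; []; _∷_; [_]; map; _++_; upTo; applyUpTo; length)
open import Data.List.Properties using (map-++; map-∘; map-cong; map-upTo; upTo-∷ʳ; length-map; length-upTo)
open import Function using (_∘_)
open import Relation.Binary.PropositionalEquality as ≡ using (_≡_)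

range-cons : ∀ {a b} → a ≤ b → range a b ≡ a ∷ range (suc a) b
range-cons {a} {b} a≤b = begin
  map (a +ℕ_) (upTo (suc b ∸ a))                    ≡⟨ ≡.cong (map (a +ℕ_) ∘ upTo) (ℕₚ.+-∸-assoc 1 a≤b) ⟩
  (a +ℕ 0) ∷ map (a +ℕ_) (applyUpTo suc (b ∸ a))    ≡⟨ ≡.cong₂ _∷_ (ℕₚ.+-identityʳ a) shifted ⟩
  a ∷ map (suc a +ℕ_) (upTo (b ∸ a))                ∎
  where
  open ≡.≡-Reasoning
  shifted : map (a +ℕ_) (applyUpTo suc (b ∸ a)) ≡ map (suc a +ℕ_) (upTo (b ∸ a))
  shifted = begin
    map (a +ℕ_) (applyUpTo suc (b ∸ a))      ≡⟨ ≡.cong (map (a +ℕ_)) (map-upTo suc (b ∸ a)) ⟨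
    map (a +ℕ_) (map suc (upTo (b ∸ a)))     ≡⟨ map-∘ (upTo (b ∸ a)) ⟨
    map ((a +ℕ_) ∘ suc) (upTo (b ∸ a))       ≡⟨ map-cong (ℕₚ.+-suc a) (upTo (b ∸ a)) ⟩
    map (suc a +ℕ_) (upTo (b ∸ a))           ∎

range-1-snoc : ∀ m → range 1 (suc m) ≡ range 1 m ++ [ suc m ]
range-1-snoc m = ≡.trans (≡.cong (map suc) (≡.sym (upTo-∷ʳ m))) (map-++ suc (upTo m) [ m ])

length-range : ∀ a b → length (range a b) ≡ suc b ∸ a
length-range a b = ≡.trans (length-map (a +ℕ_) (upTo (suc b ∸ a))) (length-upTo (suc b ∸ a))

choose-short : ∀ {k} (l : List ℕ) → length l < k → choose k l ≡ []
choose-short {suc k} []       _        = ≡.refl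
choose-short {suc k} (i ∷ is) (s≤s lt)
  rewrite choose-short is lt | choose-short is (ℕₚ.m<n⇒m<1+n lt) = ≡.refl

m∸n≡1+m∸[1+n] : ∀ {m n} → n < m → m ∸ n ≡ suc (m ∸ suc n)
m∸n≡1+m∸[1+n] = ℕₚ.+-∸-assoc 1

[m+n]∸[1+m+o]<n∸o : ∀ m {n o} → o < n → (m +ℕ n) ∸ suc (m +ℕ o) < n ∸ o
[m+n]∸[1+m+o]<n∸o m {n} {o} o<n = ≡.subst (_< n ∸ o) n∸1+o≡ (ℕₚ.∸-monoʳ-< (ℕₚ.n<1+n o) o<n)
  where
  n∸1+o≡ : n ∸ suc o ≡ (m +ℕ n) ∸ suc (m +ℕ o)
  n∸1+o≡ = ≡.trans (≡.sym (ℕₚ.[m+n]∸[m+o]≡n∸o m n (suc o))) (≡.cong ((m +ℕ n) ∸_) (ℕₚ.+-suc m o))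

module Identity {c ℓ} (R : CommutativeRing c ℓ) (x : ℕ → CommutativeRing.Carrier R) where
  open CommutativeRing R
  open Sym R x
  open import Algebra.Properties.Ring ring using (-1*x≈-x; -‿+-comm; -‿involutive; -0#≈0#; xyx⁻¹≈y)
  open import Algebra.Properties.CommutativeSemigroup +-commutativeSemigroup using (interchange)
  open import Algebra.Solver.Ring.NaturalCoefficients.Default commutativeSemiring using (solve; _:=_; _:+_; _:*_)
  open import Relation.Binary.Reasoning.Setoid setoid

  sumR-++ : ∀ l m → sumR (l ++ m) ≈ sumR l + sumR m
  sumR-++ []      m = sym (+-identityˡ (sumR m))
  sumR-++ (a ∷ l) m = trans (+-congˡ (sumR-++ l m)) (sym (+-assoc a (sumR l) (sumR m)))

  sumRange-cong : ∀ {f g} a b → (∀ t → f t ≈ g t) → sumRange a b f ≈ sumRange a b g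
  sumRange-cong {f} {g} a b f≈g = go (range a b)
    where
    go : ∀ l → sumR (map f l) ≈ sumR (map g l)
    go []      = refl
    go (t ∷ l) = +-cong (f≈g t) (go l)

  sum-monomial-∷ : ∀ i L → sumR (map monomial (map (i ∷_) L)) ≈ x i * sumR (map monomial L)
  sum-monomial-∷ i []      = sym (zeroʳ (x i))
  sum-monomial-∷ i (l ∷ L) = trans (+-congˡ (sum-monomial-∷ i L)) (sym (distribˡ (x i) (monomial l) _))

  sum-monomial-split : ∀ i L M →
    sumR (map monomial (map (i ∷_) L ++ M)) ≈ x i * sumR (map monomial L) + sumR (map monomial M)
  sum-monomial-split i L M = begin
    sumR (map monomial (map (i ∷_) L ++ M))                       ≡⟨ ≡.cong sumR (map-++ monomial (map (i ∷_) L) M) ⟩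
    sumR (map monomial (map (i ∷_) L) ++ map monomial M)          ≈⟨ sumR-++ (map monomial (map (i ∷_) L)) (map monomial M) ⟩
    sumR (map monomial (map (i ∷_) L)) + sumR (map monomial M)    ≈⟨ +-congʳ (sum-monomial-∷ i L) ⟩
    x i * sumR (map monomial L) + sumR (map monomial M)           ∎

  e-zero : ∀ a b → e 0 a b ≈ 1#
  e-zero a b = +-identityʳ 1#

  e-∸-self : ∀ d a b → e (d ∸ d) a b ≈ 1#
  e-∸-self d a b = trans (reflexive (≡.cong (λ k → e k a b) (ℕₚ.n∸n≡0 d))) (e-zero a b)

  ẽ-zero : ∀ a b → ẽ 0 a b ≈ 1#
  ẽ-zero a b = +-identityʳ 1#

  e-suc : ∀ k {a b} → a ≤ b → e (suc k) a b ≈ x a * e k (suc a) b + e (suc k) (suc a) b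
  e-suc k {a} {b} a≤b rewrite range-cons a≤b =
    sum-monomial-split a (choose k (range (suc a) b)) (choose (suc k) (range (suc a) b))

  ẽ-suc : ∀ k {a b} → a ≤ b → ẽ (suc k) a b ≈ x a * ẽ k a b + ẽ (suc k) (suc a) b
  ẽ-suc k {a} {b} a≤b rewrite range-cons a≤b =
    sum-monomial-split a (multichoose k (a ∷ range (suc a) b)) (multichoose (suc k) (range (suc a) b))

  e-vanish : ∀ {k a b} → suc b ∸ a < k → e k a b ≈ 0#
  e-vanish {k} {a} {b} short
    rewrite choose-short (range a b) (≡.subst (_< k) (≡.sym (length-range a b)) short) = refl

  e-ẽ-exchange : ∀ k t {c r n} → c ≤ r → c ≤ n →
    e k (suc c) r * ẽ (suc t) c n + e (suc k) (suc c) r * ẽ t c n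
      ≈ e k (suc c) r * ẽ (suc t) (suc c) n + e (suc k) c r * ẽ t c n
  e-ẽ-exchange k t {c} {r} {n} c≤r c≤n = begin
    E * ẽ (suc t) c n + E′ * H        ≈⟨ +-congʳ (*-congˡ (ẽ-suc t c≤n)) ⟩
    E * (x c * H + H₁) + E′ * H       ≈⟨ solve 5 (λ E X H H₁ E′ → E :* (X :* H :+ H₁) :+ E′ :* H
                                                              := E :* H₁ :+ (X :* E :+ E′) :* H)
                                             refl E (x c) H H₁ E′ ⟩
    E * H₁ + (x c * E + E′) * H       ≈⟨ +-congˡ (*-congʳ (sym (e-suc k c≤r))) ⟩
    E * H₁ + e (suc k) c r * H        ∎
    where
    E  = e k (suc c) r
    E′ = e (suc k) (suc c) r
    H  = ẽ t c n
    H₁ = ẽ (suc t) (suc c) n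

  sgn-suc : ∀ k y → sgn (suc k) * y ≈ - (sgn k * y)
  sgn-suc k y = trans (*-assoc (- 1#) (sgn k) y) (-1*x≈-x (sgn k * y))

  sgn-suc-suc : ∀ k y → sgn (suc (suc k)) * y ≈ sgn k * y
  sgn-suc-suc k y = trans (sgn-suc (suc k) y) (trans (-‿cong (sgn-suc k y)) (-‿involutive (sgn k * y)))

  altSum : ℕ → (ℕ → Carrier) → Carrier
  altSum zero    f = 0#
  altSum (suc m) f = f 0 - altSum m (f ∘ suc)

  altSum-cong : ∀ m {f g} → (∀ t → t < m → f t ≈ g t) → altSum m f ≈ altSum m g
  altSum-cong zero    f≈g = refl
  altSum-cong (suc m) f≈g = +-cong (f≈g 0 z<s) (-‿cong (altSum-cong m (λ t t<m → f≈g (suc t) (s≤s t<m))))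

  altSum-vanish : ∀ m {f} → (∀ t → t < m → f t ≈ 0#) → altSum m f ≈ 0#
  altSum-vanish zero    f≈0 = refl
  altSum-vanish (suc m) f≈0 =
    trans (+-cong (f≈0 0 z<s) (-‿cong (altSum-vanish m (λ t t<m → f≈0 (suc t) (s≤s t<m)))))
          (-‿inverseʳ 0#)

  altSum-+ : ∀ m f g → altSum m (λ t → f t + g t) ≈ altSum m f + altSum m g
  altSum-+ zero    f g = sym (+-identityʳ 0#)
  altSum-+ (suc m) f g = begin
    (f 0 + g 0) - altSum m (λ t → f (suc t) + g (suc t)) ≈⟨ +-congˡ (-‿cong (altSum-+ m (f ∘ suc) (g ∘ suc))) ⟩
    (f 0 + g 0) - (A + B)                                ≈⟨ +-congˡ (-‿+-comm A B) ⟨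
    (f 0 + g 0) + (- A + - B)                            ≈⟨ interchange (f 0) (g 0) (- A) (- B) ⟩
    (f 0 - A) + (g 0 - B)                                ∎
    where
    A = altSum m (f ∘ suc)
    B = altSum m (g ∘ suc)

  altSum-snoc : ∀ m f → altSum (suc m) f ≈ altSum m f + sgn m * f m
  altSum-snoc zero    f = begin
    f 0 - 0#        ≈⟨ +-congˡ -0#≈0# ⟩
    f 0 + 0#        ≈⟨ +-identityʳ (f 0) ⟩
    f 0             ≈⟨ *-identityˡ (f 0) ⟨
    1# * f 0        ≈⟨ +-identityˡ (1# * f 0) ⟨
    0# + 1# * f 0   ∎
  altSum-snoc (suc m) f = begin
    f 0 - altSum (suc m) (f ∘ suc)       ≈⟨ +-congˡ (-‿cong (altSum-snoc m (f ∘ suc))) ⟩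
    f 0 - (A + sgn m * f (suc m))        ≈⟨ +-congˡ (-‿+-comm A (sgn m * f (suc m))) ⟨
    f 0 + (- A + - (sgn m * f (suc m)))  ≈⟨ +-assoc (f 0) (- A) _ ⟨
    (f 0 - A) - sgn m * f (suc m)        ≈⟨ +-congˡ (sgn-suc m (f (suc m))) ⟨
    (f 0 - A) + sgn (suc m) * f (suc m)  ∎
    where
    A = altSum m (f ∘ suc)

  altSum-suc-+ : ∀ m f → altSum (suc m) f + altSum m (f ∘ suc) ≈ f 0
  altSum-suc-+ m f = begin
    (f 0 - A) + A       ≈⟨ +-assoc (f 0) (- A) A ⟩
    f 0 + (- A + A)     ≈⟨ +-congˡ (-‿inverseˡ A) ⟩
    f 0 + 0#            ≈⟨ +-identityʳ (f 0) ⟩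
    f 0                 ∎
    where
    A = altSum m (f ∘ suc)

  altSum-telescope : ∀ m g → altSum m (λ t → g (suc t) + g t) + sgn m * g m ≈ g 0
  altSum-telescope m g = begin
    altSum m (λ t → g (suc t) + g t) + sgn m * g m      ≈⟨ +-congʳ (altSum-+ m (g ∘ suc) g) ⟩
    (altSum m (g ∘ suc) + altSum m g) + sgn m * g m     ≈⟨ +-assoc (altSum m (g ∘ suc)) (altSum m g) _ ⟩
    altSum m (g ∘ suc) + (altSum m g + sgn m * g m)     ≈⟨ +-congˡ (altSum-snoc m g) ⟨
    altSum m (g ∘ suc) + altSum (suc m) g               ≈⟨ +-comm (altSum m (g ∘ suc)) (altSum (suc m) g) ⟩
    altSum (suc m) g + altSum m (g ∘ suc)               ≈⟨ altSum-suc-+ m g ⟩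
    g 0                                                 ∎

  sumRange-altSum : ∀ m f → sumRange 1 m (λ t → sgn (suc t) * f t) ≈ altSum m (f ∘ suc)
  sumRange-altSum zero    f = refl
  sumRange-altSum (suc m) f = begin
    sumR (map F (range 1 (suc m)))              ≡⟨ ≡.cong (sumR ∘ map F) (range-1-snoc m) ⟩
    sumR (map F (range 1 m ++ [ suc m ]))       ≡⟨ ≡.cong sumR (map-++ F (range 1 m) [ suc m ]) ⟩
    sumR (map F (range 1 m) ++ [ F (suc m) ])   ≈⟨ sumR-++ (map F (range 1 m)) [ F (suc m) ] ⟩
    sumRange 1 m F + (F (suc m) + 0#)           ≈⟨ +-cong (sumRange-altSum m f) (trans (+-identityʳ _) (sgn-suc-suc m (f (suc m)))) ⟩
    altSum m (f ∘ suc) + sgn m * f (suc m)      ≈⟨ altSum-snoc m (f ∘ suc) ⟨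
    altSum (suc m) (f ∘ suc)                    ∎
    where
    F = λ t → sgn (suc t) * f t

  module Shift (d r n : ℕ) where

    term term⁺ : ℕ → ℕ → Carrier
    term  a t = e (d ∸ t) (suc (a +ℕ t)) r * ẽ t (a +ℕ t) n
    term⁺ a t = e (d ∸ t) (suc (a +ℕ t)) r * ẽ t (suc (a +ℕ t)) n

    shiftedSum : ℕ → Carrier
    shiftedSum a = altSum (suc d) (term a)

    term-exchange : ∀ {a t} → t < d → a +ℕ d ≤ r → r ≤ n →
      term a (suc t) + term (suc a) t ≈ term⁺ a (suc t) + term⁺ a t
    term-exchange {a} {t} t<d a+d≤r r≤n
      rewrite ℕₚ.+-suc a t | m∸n≡1+m∸[1+n] t<d =
      e-ẽ-exchange (d ∸ suc t) t c≤r (ℕₚ.≤-trans c≤r r≤n)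
      where
      c≤r : suc (a +ℕ t) ≤ r
      c≤r = ℕₚ.≤-trans (ℕₚ.+-monoʳ-< a t<d) a+d≤r

    shiftedSum-step : ∀ {a} → a +ℕ d ≤ r → r ≤ n → shiftedSum a ≈ shiftedSum (suc a)
    shiftedSum-step {a} a+d≤r r≤n = begin
      term a 0 - A                          ≈⟨ +-congʳ (*-congˡ (trans (ẽ-zero (a +ℕ 0) n) (sym (ẽ-zero (suc (a +ℕ 0)) n)))) ⟩
      term⁺ a 0 - A                         ≈⟨ +-congʳ telescoped ⟨
      (A + B + sgn d * term⁺ a d) - A       ≈⟨ +-congʳ (+-assoc A B _) ⟩
      (A + (B + sgn d * term⁺ a d)) - A     ≈⟨ xyx⁻¹≈y A _ ⟩
      B + sgn d * term⁺ a d                 ≈⟨ +-congˡ (*-congˡ (*-congʳ (trans (e-∸-self d _ r) (sym (e-∸-self d _ r))))) ⟩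
      B + sgn d * term (suc a) d            ≈⟨ altSum-snoc d (term (suc a)) ⟨
      shiftedSum (suc a)                    ∎
      where
      A = altSum d (term a ∘ suc)
      B = altSum d (term (suc a))
      telescoped : A + B + sgn d * term⁺ a d ≈ term⁺ a 0
      telescoped = begin
        A + B + sgn d * term⁺ a d
          ≈⟨ +-congʳ (altSum-+ d (term a ∘ suc) (term (suc a))) ⟨
        altSum d (λ t → term a (suc t) + term (suc a) t) + sgn d * term⁺ a d
          ≈⟨ +-congʳ (altSum-cong d (λ t t<d → term-exchange t<d a+d≤r r≤n)) ⟩
        altSum d (λ t → term⁺ a (suc t) + term⁺ a t) + sgn d * term⁺ a d
          ≈⟨ altSum-telescope d (term⁺ a) ⟩
        term⁺ a 0
          ∎

    shiftedSum-invariant : ∀ j → j +ℕ d ≤ suc r → r ≤ n → shiftedSum 0 ≈ shiftedSum j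
    shiftedSum-invariant zero    _            r≤n = refl
    shiftedSum-invariant (suc j) (s≤s j+d≤r) r≤n =
      trans (shiftedSum-invariant j (ℕₚ.m≤n⇒m≤1+n j+d≤r) r≤n) (shiftedSum-step j+d≤r r≤n)

    shiftedSum-last : ∀ j → j +ℕ d ≡ suc r → shiftedSum j ≈ sgn d * ẽ d (suc r) n
    shiftedSum-last j j+d≡1+r = begin
      shiftedSum j                       ≈⟨ altSum-snoc d (term j) ⟩
      altSum d (term j) + sgn d * term j d
        ≈⟨ +-cong (altSum-vanish d (λ t t<d → trans (*-congʳ (e-vanish (short t<d))) (zeroˡ _)))
                  (*-congˡ (*-cong (e-∸-self d _ r) (reflexive (≡.cong (λ a → ẽ d a n) j+d≡1+r)))) ⟩
      0# + sgn d * (1# * ẽ d (suc r) n)  ≈⟨ +-identityˡ _ ⟩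
      sgn d * (1# * ẽ d (suc r) n)       ≈⟨ *-congˡ (*-identityˡ _) ⟩
      sgn d * ẽ d (suc r) n              ∎
      where
      short : ∀ {t} → t < d → suc r ∸ suc (j +ℕ t) < d ∸ t
      short {t} t<d = ≡.subst (λ m → m ∸ suc (j +ℕ t) < d ∸ t) j+d≡1+r ([m+n]∸[1+m+o]<n∸o j t<d)

proposition6p5 : ∀ {c ℓ} (R : CommutativeRing c ℓ) (x : ℕ → CommutativeRing.Carrier R)
                   (d r n : ℕ) → 0 < d → d ≤ r → r ≤ n →
                   let open CommutativeRing R
                       open Sym R x
                   in e d 1 r ≈ sgn d * ẽ d (suc r) n
                                + sumRange 1 d (λ t → sgn (suc t) * e (d ∸ t) (suc t) r * ẽ t t n)
proposition6p5 R x d r n _ d≤r r≤n = begin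
  e d 1 r                                          ≈⟨ trans (*-congˡ (ẽ-zero 0 n)) (*-identityʳ _) ⟨
  term 0 0                                         ≈⟨ altSum-suc-+ d (term 0) ⟨
  shiftedSum 0 + altSum d (term 0 ∘ suc)           ≈⟨ +-congʳ (shiftedSum-invariant j (ℕₚ.≤-reflexive j+d≡1+r) r≤n) ⟩
  shiftedSum j + altSum d (term 0 ∘ suc)           ≈⟨ +-congʳ (shiftedSum-last j j+d≡1+r) ⟩
  sgn d * ẽ d (suc r) n + altSum d (term 0 ∘ suc)  ≈⟨ +-congˡ sum≈altSum ⟨
  sgn d * ẽ d (suc r) n + sumRange 1 d (λ t → sgn (suc t) * e (d ∸ t) (suc t) r * ẽ t t n) ∎
  where
  open CommutativeRing R
  open Sym R x
  open Identity R x
  open Shift d r n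
  open import Relation.Binary.Reasoning.Setoid setoid
  j = suc r ∸ d
  j+d≡1+r : j +ℕ d ≡ suc r
  j+d≡1+r = ℕₚ.m∸n+n≡m (ℕₚ.m≤n⇒m≤1+n d≤r)
  sum≈altSum : sumRange 1 d (λ t → sgn (suc t) * e (d ∸ t) (suc t) r * ẽ t t n) ≈ altSum d (term 0 ∘ suc)
  sum≈altSum = trans (sumRange-cong 1 d (λ t → *-assoc _ _ _)) (sumRange-altSum d (term 0))
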